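{- Let $H$ be an intersecting $r$-partite hypergraph with covering number $\tau=\tau(H)$. Suppose $H$ has maximum degree at most $4$, and for $i=1,2,3,4$ let $x_i$ denote the number of vertices of degree $i$ in $H$. Then \[ x_1+x_4\ \ge\ \binom{|H|}{2}+3r\tau-2r|H| \qquad\text{and}\qquad x_3+3x_4\ \ge\ \binom{|H|}{2}+r\tau-r|H|. \] In each of these two inequalities, equality holds if and only if $H$ is linear and has exactly $\tau$ vertices on each side.
   Context: $|H|$ denotes the number of edges of $H$. A hypergraph is $r$-partite if its vertex set can be partitioned into $r$ sets $V_1,\dots,V_r$ (the sides) so that every edge contains exactly one vertex from each side. $H$ is intersecting if every two edges share a vertex. An intersecting hypergraph is linear if every two distinct edges meet in exactly one vertex. The covering number $\tau(H)$ is the minimum size of a set of vertices meeting every edge. -}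

module Defs where

open import Data.Nat using (ℕ; _≤_; _≟_)
open import Data.Fin using (Fin)
import Data.Fin as F
open import Data.List using (List; length; filter; lookup; concatMap; map; allFin)
open import Data.Product using (Σ; ∃; _,_; _×_)
open import Relation.Binary.PropositionalEquality using (_≡_; _≢_)
open import Data.List.Membership.Propositional using (_∈_)

-- An r-partite hypergraph with sides V_j = {j} × Fin (m j), j : Fin r.
-- Vertices: pairs (j , k) with k : Fin (m j).
Vertex : (r : ℕ) → (Fin r → ℕ) → Set
Vertex r m = Σ (Fin r) (λ j → Fin (m j))

Edge : (r : ℕ) → (Fin r → ℕ) → Set
Edge r m = (j : Fin r) → Fin (m j)

-- A hypergraph is a finite list (multiset) of edges; |H| = length H.
Hypergraph : (r : ℕ) → (Fin r → ℕ) → Set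
Hypergraph r m = List (Edge r m)

module _ {r : ℕ} {m : Fin r → ℕ} where

  _∋_ : Edge r m → Vertex r m → Set
  e ∋ (j , k) = e j ≡ k

  vertices : List (Vertex r m)
  vertices = concatMap (λ j → map (λ k → (j , k)) (allFin (m j))) (allFin r)

  deg : Hypergraph r m → Vertex r m → ℕ
  deg H (j , k) = length (filter (λ e → e j F.≟ k) H)

  numDeg : Hypergraph r m → ℕ → ℕ
  numDeg H i = length (filter (λ v → deg H v ≟ i) vertices)

  common : Edge r m → Edge r m → ℕ
  common e f = length (filter (λ j → e j F.≟ f j) (allFin r))

  Intersecting : Hypergraph r m → Set
  Intersecting H = (a b : Fin (length H)) → a ≢ b →
    ∃ λ v → (lookup H a ∋ v) × (lookup H b ∋ v)

  Linear : Hypergraph r m → Set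
  Linear H = (a b : Fin (length H)) → a ≢ b → common (lookup H a) (lookup H b) ≡ 1

  IsCover : Hypergraph r m → List (Vertex r m) → Set
  IsCover H C = (a : Fin (length H)) → ∃ λ v → (v ∈ C) × (lookup H a ∋ v)

  IsCoveringNumber : Hypergraph r m → ℕ → Set
  IsCoveringNumber H t =
    (∃ λ C → IsCover H C × length C ≡ t) ×
    ((C : List (Vertex r m)) → IsCover H C → t ≤ length C)

module Submission where

-- The proof is a double count of the vertex degrees of H.  Write N, D and Q
-- for the sums of 1, deg v and (deg v choose 2) over all vertices v.  Then
--   * N = Σ_j m_j = rτ + a, where a = Σ_j (m_j − τ) ≥ 0 because every side
--     is a cover, and a = 0 iff every side has exactly τ vertices;
--   * D = r|H|, since every edge has one vertex on each of the r sides;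
--   * Q = Σ_{pairs e,f} |e ∩ f| = C(|H|,2) + b with b ≥ 0 because H is
--     intersecting, and b = 0 iff H is linear.
-- Since all degrees lie in {1,2,3,4}, N, D and Q are the linear combinations
-- x₁+x₂+x₃+x₄, x₁+2x₂+3x₃+4x₄ and x₂+3x₃+6x₄ of the degree counts, and
--   x₁+x₄ = 3N − 2D + Q = C(|H|,2) + 3rτ − 2r|H| + (b + 3a),
--   x₃+3x₄ = N − D + Q = C(|H|,2) + rτ − r|H| + (b + a),
-- which give both inequalities together with their equality cases.

open import Defs
open import Data.Nat using (ℕ; _≤_)
open import Data.Fin using (Fin)

module FiniteSums where

  open import Data.Nat using (suc; _+_; _*_)
  open import Data.Nat.Properties
  open import Data.Fin using () renaming (zero to fz; suc to fs)
  import Data.Fin as F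
  open import Data.Bool using (true; false; if_then_else_)
  open import Data.List using (List; []; _∷_; length; filter; lookup; concatMap; map; allFin; _++_)
  open import Data.List.Properties using (map-tabulate; length-tabulate)
  open import Data.List.Membership.Propositional using (_∈_)
  open import Data.List.Relation.Unary.Any using (here; there)
  open import Relation.Nullary using (Dec; yes; no; does)
  open import Relation.Binary.PropositionalEquality using (_≡_; refl; sym; trans; cong; cong₂; module ≡-Reasoning)
  open import Data.Empty using (⊥-elim)
  open import Data.Nat.Tactic.RingSolver using (solve-∀)

  ∑ : ∀ {a} {A : Set a} → List A → (A → ℕ) → ℕ
  ∑ [] f = 0
  ∑ (x ∷ xs) f = f x + ∑ xs f

  [_] : ∀ {p} {P : Set p} → Dec P → ℕ
  [ d ] = if does d then 1 else 0

  module _ {a} {A : Set a} where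

    ∑-cong : (xs : List A) {f g : A → ℕ} → (∀ x → f x ≡ g x) → ∑ xs f ≡ ∑ xs g
    ∑-cong [] eq = refl
    ∑-cong (x ∷ xs) eq = cong₂ _+_ (eq x) (∑-cong xs eq)

    ∑-+ : (xs : List A) (f g : A → ℕ) → ∑ xs (λ x → f x + g x) ≡ ∑ xs f + ∑ xs g
    ∑-+ [] f g = refl
    ∑-+ (x ∷ xs) f g rewrite ∑-+ xs f g = interchange (f x) (g x) (∑ xs f) (∑ xs g)
      where interchange : ∀ p q s t → p + q + (s + t) ≡ p + s + (q + t)
            interchange = solve-∀

    ∑-zero : (xs : List A) → ∑ xs (λ _ → 0) ≡ 0
    ∑-zero [] = refl
    ∑-zero (x ∷ xs) = ∑-zero xs

    ∑-*ʳ : (xs : List A) (f : A → ℕ) (c : ℕ) → ∑ xs (λ x → f x * c) ≡ ∑ xs f * c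
    ∑-*ʳ [] f c = refl
    ∑-*ʳ (x ∷ xs) f c = trans (cong (f x * c +_) (∑-*ʳ xs f c)) (sym (*-distribʳ-+ c (f x) (∑ xs f)))

    ∑-const : (xs : List A) (c : ℕ) → ∑ xs (λ _ → c) ≡ length xs * c
    ∑-const [] c = refl
    ∑-const (x ∷ xs) c = cong (c +_) (∑-const xs c)

    ∑-++ : (xs ys : List A) (f : A → ℕ) → ∑ (xs ++ ys) f ≡ ∑ xs f + ∑ ys f
    ∑-++ [] ys f = refl
    ∑-++ (x ∷ xs) ys f rewrite ∑-++ xs ys f = sym (+-assoc (f x) (∑ xs f) (∑ ys f))

    term≤∑ : {x : A} (xs : List A) (f : A → ℕ) → x ∈ xs → f x ≤ ∑ xs f
    term≤∑ (y ∷ xs) f (here refl) = m≤m+n (f y) (∑ xs f)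
    term≤∑ (y ∷ xs) f (there p) = ≤-trans (term≤∑ xs f p) (m≤n+m (∑ xs f) (f y))

    length-filter : ∀ {p} {P : A → Set p} (P? : ∀ x → Dec (P x)) (xs : List A) →
      length (filter P? xs) ≡ ∑ xs (λ x → [ P? x ])
    length-filter P? [] = refl
    length-filter P? (x ∷ xs) with does (P? x)
    ... | true = cong suc (length-filter P? xs)
    ... | false = length-filter P? xs

  module _ {a b} {A : Set a} {B : Set b} where

    ∑-swap : (xs : List A) (ys : List B) (g : A → B → ℕ) →
      ∑ xs (λ x → ∑ ys (g x)) ≡ ∑ ys (λ y → ∑ xs (λ x → g x y))
    ∑-swap [] ys g = sym (∑-zero ys)
    ∑-swap (x ∷ xs) ys g rewrite ∑-swap xs ys g = sym (∑-+ ys (g x) (λ y → ∑ xs (λ x → g x y)))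

    ∑-map : (xs : List A) (h : A → B) (f : B → ℕ) → ∑ (map h xs) f ≡ ∑ xs (λ x → f (h x))
    ∑-map [] h f = refl
    ∑-map (x ∷ xs) h f = cong (f (h x) +_) (∑-map xs h f)

    ∑-concatMap : (xs : List A) (g : A → List B) (f : B → ℕ) →
      ∑ (concatMap g xs) f ≡ ∑ xs (λ x → ∑ (g x) f)
    ∑-concatMap [] g f = refl
    ∑-concatMap (x ∷ xs) g f =
      trans (∑-++ (g x) (concatMap g xs) f) (cong (∑ (g x) f +_) (∑-concatMap xs g f))

  ∑-allFin-suc : ∀ n (f : Fin (suc n) → ℕ) → ∑ (allFin (suc n)) f ≡ f fz + ∑ (allFin n) (λ k → f (fs k))
  ∑-allFin-suc n f =
    cong (f fz +_) (trans (cong (λ xs → ∑ xs f) (sym (map-tabulate (λ k → k) fs))) (∑-map (allFin n) fs f))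

  length-allFin : ∀ n → length (allFin n) ≡ n
  length-allFin n = length-tabulate (λ k → k)

  ∑-lookup : ∀ {a} {A : Set a} (xs : List A) (f : A → ℕ) →
    ∑ xs f ≡ ∑ (allFin (length xs)) (λ i → f (lookup xs i))
  ∑-lookup [] f = refl
  ∑-lookup (x ∷ xs) f =
    trans (cong (f x +_) (∑-lookup xs f)) (sym (∑-allFin-suc (length xs) (λ i → f (lookup (x ∷ xs) i))))

  ∑-pick : ∀ n (x : Fin n) (g : Fin n → ℕ) → ∑ (allFin n) (λ k → [ x F.≟ k ] * g k) ≡ g x
  ∑-pick (suc n) fz g = begin
      ∑ (allFin (suc n)) (λ k → [ fz F.≟ k ] * g k)
    ≡⟨ ∑-allFin-suc n _ ⟩
      (g fz + 0) + ∑ (allFin n) (λ _ → 0)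
    ≡⟨ cong₂ _+_ (+-identityʳ (g fz)) (∑-zero (allFin n)) ⟩
      g fz + 0
    ≡⟨ +-identityʳ (g fz) ⟩
      g fz
    ∎
    where open ≡-Reasoning
  ∑-pick (suc n) (fs x) g =
    trans (∑-allFin-suc n (λ k → [ fs x F.≟ k ] * g k)) (∑-pick n x (λ k → g (fs k)))

  []-sym : ∀ {n} (x y : Fin n) → [ x F.≟ y ] ≡ [ y F.≟ x ]
  []-sym x y with x F.≟ y | y F.≟ x
  ... | yes _ | yes _ = refl
  ... | no _ | no _ = refl
  ... | yes p | no q = ⊥-elim (q (sym p))
  ... | no q | yes p = ⊥-elim (q (sym p))

module DoubleCounting {r : ℕ} {m : Fin r → ℕ} where

  open FiniteSums
  open import Data.Nat using (_+_; _*_)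
  open import Data.Nat.Properties using (*-identityʳ; +-identityʳ)
  open import Data.Nat.Combinatorics using (_C_; nCk+nC[k+1]≡[n+1]C[k+1]; nC1≡n)
  import Data.Fin as F
  open import Data.Bool using (true; false; if_then_else_)
  open import Data.List using ([]; _∷_; length; allFin)
  open import Data.Product using (_,_; proj₁; proj₂)
  open import Relation.Nullary using (does)
  open import Relation.Binary.PropositionalEquality using (_≡_; refl; sym; trans; cong; cong₂; module ≡-Reasoning)

  ∑-vertices : (F : Vertex r m → ℕ) →
    ∑ (vertices {r} {m}) F ≡ ∑ (allFin r) (λ j → ∑ (allFin (m j)) (λ k → F (j , k)))
  ∑-vertices F =
    trans (∑-concatMap (allFin r) _ F) (∑-cong (allFin r) (λ j → ∑-map (allFin (m j)) (λ k → (j , k)) F))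

  deg-∑ : (H : Hypergraph r m) (j : Fin r) (k : Fin (m j)) → deg H (j , k) ≡ ∑ H (λ e → [ e j F.≟ k ])
  deg-∑ H j k = length-filter (λ e → e j F.≟ k) H

  common-∑ : (e f : Edge r m) → common e f ≡ ∑ (allFin r) (λ j → [ e j F.≟ f j ])
  common-∑ e f = length-filter (λ j → e j F.≟ f j) (allFin r)

  common-sym : (e f : Edge r m) → common e f ≡ common f e
  common-sym e f =
    trans (common-∑ e f) (trans (∑-cong (allFin r) (λ j → []-sym (e j) (f j))) (sym (common-∑ f e)))

  vertexCount : ∑ (vertices {r} {m}) (λ _ → 1) ≡ ∑ (allFin r) m
  vertexCount = trans (∑-vertices (λ _ → 1)) (∑-cong (allFin r) sideSize)
    where
      sideSize : ∀ j → ∑ (allFin (m j)) (λ _ → 1) ≡ m j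
      sideSize j = trans (∑-const (allFin (m j)) 1)
                         (trans (*-identityʳ (length (allFin (m j)))) (length-allFin (m j)))

  -- Handshake lemma: every edge has exactly one vertex on each of the r sides.
  handshake : (H : Hypergraph r m) → ∑ (vertices {r} {m}) (deg H) ≡ r * length H
  handshake H = begin
      ∑ vertices (deg H)
    ≡⟨ ∑-vertices (deg H) ⟩
      ∑ (allFin r) (λ j → ∑ (allFin (m j)) (λ k → deg H (j , k)))
    ≡⟨ ∑-cong (allFin r) (λ j → ∑-cong (allFin (m j)) (deg-∑ H j)) ⟩
      ∑ (allFin r) (λ j → ∑ (allFin (m j)) (λ k → ∑ H (λ e → [ e j F.≟ k ])))
    ≡⟨ ∑-cong (allFin r) (λ j → ∑-swap (allFin (m j)) H _) ⟩
      ∑ (allFin r) (λ j → ∑ H (λ e → ∑ (allFin (m j)) (λ k → [ e j F.≟ k ])))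
    ≡⟨ ∑-cong (allFin r) (λ j → ∑-cong H (λ e → oneVertexOnSide j e)) ⟩
      ∑ (allFin r) (λ _ → ∑ H (λ _ → 1))
    ≡⟨ ∑-const (allFin r) (∑ H (λ _ → 1)) ⟩
      length (allFin r) * ∑ H (λ _ → 1)
    ≡⟨ cong₂ _*_ (length-allFin r) (trans (∑-const H 1) (*-identityʳ (length H))) ⟩
      r * length H
    ∎
    where
      open ≡-Reasoning
      oneVertexOnSide : ∀ j (e : Edge r m) → ∑ (allFin (m j)) (λ k → [ e j F.≟ k ]) ≡ 1
      oneVertexOnSide j e =
        trans (∑-cong (allFin (m j)) (λ k → sym (*-identityʳ [ e j F.≟ k ]))) (∑-pick (m j) (e j) (λ _ → 1))

  incidences : (e : Edge r m) (H : Hypergraph r m) →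
    ∑ (vertices {r} {m}) (λ v → [ e (proj₁ v) F.≟ proj₂ v ] * deg H v) ≡ ∑ H (common e)
  incidences e H = begin
      ∑ vertices (λ v → [ e (proj₁ v) F.≟ proj₂ v ] * deg H v)
    ≡⟨ ∑-vertices _ ⟩
      ∑ (allFin r) (λ j → ∑ (allFin (m j)) (λ k → [ e j F.≟ k ] * deg H (j , k)))
    ≡⟨ ∑-cong (allFin r) (λ j → ∑-pick (m j) (e j) (λ k → deg H (j , k))) ⟩
      ∑ (allFin r) (λ j → deg H (j , e j))
    ≡⟨ ∑-cong (allFin r) (λ j → deg-∑ H j (e j)) ⟩
      ∑ (allFin r) (λ j → ∑ H (λ f → [ f j F.≟ e j ]))
    ≡⟨ ∑-swap (allFin r) H _ ⟩
      ∑ H (λ f → ∑ (allFin r) (λ j → [ f j F.≟ e j ]))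
    ≡⟨ ∑-cong H (λ f → trans (sym (common-∑ f e)) (common-sym f e)) ⟩
      ∑ H (common e)
    ∎
    where open ≡-Reasoning

  commonPairs : Hypergraph r m → ℕ
  commonPairs [] = 0
  commonPairs (e ∷ H) = ∑ H (common e) + commonPairs H

  C2-step : ∀ b d → ((if b then 1 else 0) + d) C 2 ≡ (if b then 1 else 0) * d + d C 2
  C2-step false d = refl
  C2-step true d =
    trans (sym (nCk+nC[k+1]≡[n+1]C[k+1] d 1)) (cong (_+ d C 2) (trans (nC1≡n d) (sym (+-identityʳ d))))

  -- Each vertex of degree d lies in C(d, 2) pairs of edges: Σ_v C(deg v, 2) counts
  -- the pairs of edges through each common vertex.
  pairCount : (H : Hypergraph r m) → ∑ (vertices {r} {m}) (λ v → deg H v C 2) ≡ commonPairs H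
  pairCount [] = ∑-zero (vertices {r} {m})
  pairCount (e ∷ H) = begin
      ∑ vertices (λ v → deg (e ∷ H) v C 2)
    ≡⟨ ∑-cong (vertices {r} {m}) addEdge ⟩
      ∑ vertices (λ v → [ e (proj₁ v) F.≟ proj₂ v ] * deg H v + deg H v C 2)
    ≡⟨ ∑-+ (vertices {r} {m}) _ _ ⟩
      ∑ vertices (λ v → [ e (proj₁ v) F.≟ proj₂ v ] * deg H v) + ∑ vertices (λ v → deg H v C 2)
    ≡⟨ cong₂ _+_ (incidences e H) (pairCount H) ⟩
      commonPairs (e ∷ H)
    ∎
    where
      open ≡-Reasoning
      addEdge : (v : Vertex r m) → deg (e ∷ H) v C 2 ≡ [ e (proj₁ v) F.≟ proj₂ v ] * deg H v + deg H v C 2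
      addEdge (j , k) = begin
          deg (e ∷ H) (j , k) C 2
        ≡⟨ cong (_C 2) (deg-∑ (e ∷ H) j k) ⟩
          ([ e j F.≟ k ] + ∑ H (λ f → [ f j F.≟ k ])) C 2
        ≡⟨ cong (λ d → ([ e j F.≟ k ] + d) C 2) (sym (deg-∑ H j k)) ⟩
          ([ e j F.≟ k ] + deg H (j , k)) C 2
        ≡⟨ C2-step (does (e j F.≟ k)) (deg H (j , k)) ⟩
          [ e j F.≟ k ] * deg H (j , k) + deg H (j , k) C 2
        ∎

module Surplus where

  open FiniteSums
  open import Data.Nat using (zero; suc; _+_; _*_; _∸_; z≤n; s≤s)
  open import Data.Nat.Properties
  open import Data.Nat.Combinatorics using (_C_; nCk+nC[k+1]≡[n+1]C[k+1]; nC1≡n)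
  open import Data.Fin using () renaming (zero to fz; suc to fs)
  import Data.Fin as F
  import Data.Fin.Properties as FP
  open import Data.List using ([]; _∷_; length; lookup; map; allFin)
  open import Data.List.Properties using (length-map)
  open import Data.List.Membership.Propositional.Properties using (∈-allFin; ∈-map⁺)
  open import Data.Product using (∃-syntax; _,_; _×_)
  open import Data.Product.Function.NonDependent.Propositional using (_×-⇔_)
  open import Function.Bundles using (_⇔_; mk⇔)
  import Function.Properties.Equivalence as ⇔
  open import Relation.Nullary using (Dec; yes; no)
  open import Relation.Binary.PropositionalEquality using (_≡_; refl; sym; trans; cong; cong₂; module ≡-Reasoning)
  open import Data.Empty using (⊥-elim)
  open import Data.Nat.Tactic.RingSolver using (solve-∀)

  +≡0⇔ : ∀ {a b : ℕ} → (a + b ≡ 0) ⇔ ((a ≡ 0) × (b ≡ 0))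
  +≡0⇔ {a} = mk⇔ (λ eq → m+n≡0⇒m≡0 a eq , m+n≡0⇒n≡0 a eq) (λ { (refl , refl) → refl })

  surplus : ∀ n (t : ℕ) (g : Fin n → ℕ) → (∀ i → t ≤ g i) →
    ∃[ s ] (∑ (allFin n) g ≡ n * t + s) × (s ≡ 0 ⇔ (∀ i → g i ≡ t))
  surplus zero t g t≤g = 0 , refl , mk⇔ (λ _ ()) (λ _ → refl)
  surplus (suc n) t g t≤g with surplus n t (λ i → g (fs i)) (λ i → t≤g (fs i))
  ... | s , sum≡ , s≡0⇔ = (g fz ∸ t + s) , sum≡' , ⇔.trans +≡0⇔ (⇔.trans (head⇔ ×-⇔ s≡0⇔) split)
    where
      sum≡' : ∑ (allFin (suc n)) g ≡ suc n * t + (g fz ∸ t + s)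
      sum≡' = begin
          ∑ (allFin (suc n)) g
        ≡⟨ ∑-allFin-suc n g ⟩
          g fz + ∑ (allFin n) (λ i → g (fs i))
        ≡⟨ cong₂ _+_ (sym (m+[n∸m]≡n (t≤g fz))) sum≡ ⟩
          t + (g fz ∸ t) + (n * t + s)
        ≡⟨ regroup t (g fz ∸ t) (n * t) s ⟩
          t + n * t + (g fz ∸ t + s)
        ∎
        where
          open ≡-Reasoning
          regroup : ∀ t d k s → t + d + (k + s) ≡ t + k + (d + s)
          regroup = solve-∀
      head⇔ : (g fz ∸ t ≡ 0) ⇔ (g fz ≡ t)
      head⇔ = mk⇔ (λ d≡0 → ≤-antisym (m∸n≡0⇒m≤n d≡0) (t≤g fz)) (λ g≡t → trans (cong (_∸ t) g≡t) (n∸n≡0 t))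
      split : ((g fz ≡ t) × (∀ i → g (fs i) ≡ t)) ⇔ (∀ i → g i ≡ t)
      split = mk⇔ (λ { (g₀ , gₛ) → λ { fz → g₀ ; (fs i) → gₛ i } }) (λ all → all fz , λ i → all (fs i))

  module _ {r : ℕ} {m : Fin r → ℕ} where

    open DoubleCounting {r} {m}

    sideCover : (H : Hypergraph r m) (j : Fin r) → IsCover H (map (λ k → (j , k)) (allFin (m j)))
    sideCover H j a = (j , lookup H a j) , ∈-map⁺ (λ k → (j , k)) (∈-allFin (lookup H a j)) , refl

    τ≤side : (H : Hypergraph r m) (τ : ℕ) → IsCoveringNumber H τ → ∀ j → τ ≤ m j
    τ≤side H τ (_ , minimal) j =
      ≤-trans (minimal _ (sideCover H j)) (≤-reflexive (trans (length-map _ (allFin (m j))) (length-allFin (m j))))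

    vertexSurplus : (H : Hypergraph r m) (τ : ℕ) → IsCoveringNumber H τ →
      ∃[ a ] (∑ (vertices {r} {m}) (λ _ → 1) ≡ r * τ + a) × (a ≡ 0 ⇔ (∀ j → m j ≡ τ))
    vertexSurplus H τ cov with surplus r τ m (τ≤side H τ cov)
    ... | a , sum≡ , a≡0⇔ = a , trans vertexCount sum≡ , a≡0⇔

    meet : (e f : Edge r m) (v : Vertex r m) → e ∋ v → f ∋ v → 1 ≤ common e f
    meet e f (j , k) e∋v f∋v =
      ≤-trans (indicator≥1 (e j F.≟ f j))
        (≤-trans (term≤∑ (allFin r) (λ j → [ e j F.≟ f j ]) (∈-allFin j)) (≤-reflexive (sym (common-∑ e f))))
      where
        indicator≥1 : (d : Dec (e j ≡ f j)) → 1 ≤ [ d ]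
        indicator≥1 (yes _) = s≤s z≤n
        indicator≥1 (no e≢f) = ⊥-elim (e≢f (trans e∋v (sym f∋v)))

    intersecting-tail : (e : Edge r m) (H : Hypergraph r m) → Intersecting (e ∷ H) → Intersecting H
    intersecting-tail e H int a b a≢b = int (fs a) (fs b) (λ eq → a≢b (FP.suc-injective eq))

    head-meets : (e : Edge r m) (H : Hypergraph r m) → Intersecting (e ∷ H) → ∀ i → 1 ≤ common e (lookup H i)
    head-meets e H int i with int fz (fs i) (λ ())
    ... | v , e∋v , f∋v = meet e (lookup H i) v e∋v f∋v

    linear-∷ : (e : Edge r m) (H : Hypergraph r m) → ((∀ i → common e (lookup H i) ≡ 1) × Linear H) ⇔ Linear (e ∷ H)
    linear-∷ e H = mk⇔ extend (λ L → (λ i → L fz (fs i) (λ ())) , (λ a b a≢b → L (fs a) (fs b) (λ eq → a≢b (FP.suc-injective eq))))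
      where
        extend : ((∀ i → common e (lookup H i) ≡ 1) × Linear H) → Linear (e ∷ H)
        extend (meetsOnce , L) fz fz a≢b = ⊥-elim (a≢b refl)
        extend (meetsOnce , L) fz (fs i) _ = meetsOnce i
        extend (meetsOnce , L) (fs i) fz _ = trans (common-sym (lookup H i) e) (meetsOnce i)
        extend (meetsOnce , L) (fs a) (fs b) a≢b = L a b (λ eq → a≢b (cong fs eq))

    pairSurplus : (H : Hypergraph r m) → Intersecting H →
      ∃[ b ] (commonPairs H ≡ length H C 2 + b) × (b ≡ 0 ⇔ Linear H)
    pairSurplus [] _ = 0 , refl , mk⇔ (λ _ ()) (λ _ → refl)
    pairSurplus (e ∷ H) int
      with surplus (length H) 1 (λ i → common e (lookup H i)) (head-meets e H int) | pairSurplus H (intersecting-tail e H int)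
    ... | c , row≡ , c≡0⇔ | b , rest≡ , b≡0⇔ =
      (c + b) , total≡ , ⇔.trans +≡0⇔ (⇔.trans (c≡0⇔ ×-⇔ b≡0⇔) (linear-∷ e H))
      where
        h = length H
        total≡ : commonPairs (e ∷ H) ≡ suc h C 2 + (c + b)
        total≡ = begin
            ∑ H (common e) + commonPairs H
          ≡⟨ cong₂ _+_ (trans (∑-lookup H (common e)) row≡) rest≡ ⟩
            h * 1 + c + (h C 2 + b)
          ≡⟨ cong (λ k → k + c + (h C 2 + b)) (trans (*-identityʳ h) (sym (nC1≡n h))) ⟩
            h C 1 + c + (h C 2 + b)
          ≡⟨ regroup (h C 1) c (h C 2) b ⟩
            h C 1 + h C 2 + (c + b)
          ≡⟨ cong (_+ (c + b)) (nCk+nC[k+1]≡[n+1]C[k+1] h 1) ⟩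
            suc h C 2 + (c + b)
          ∎
          where
            open ≡-Reasoning
            regroup : ∀ p c q b → p + c + (q + b) ≡ p + q + (c + b)
            regroup = solve-∀

module DegreeDistribution where

  open FiniteSums
  open import Data.Nat using (suc; _+_; _*_; _≟_; s≤s)
  open import Data.Nat.Properties using (+-identityʳ)
  open import Data.List using (List; []; _∷_; length; filter)
  open import Relation.Binary.PropositionalEquality using (_≡_; sym; trans; cong; module ≡-Reasoning)

  degrees : List ℕ
  degrees = 1 ∷ 2 ∷ 3 ∷ 4 ∷ []

  count : ∀ {a} {A : Set a} → (A → ℕ) → List A → ℕ → ℕ
  count d vs i = length (filter (λ v → d v ≟ i) vs)

  select : (f : ℕ → ℕ) (d : ℕ) → 1 ≤ d → d ≤ 4 → f d ≡ ∑ degrees (λ i → [ d ≟ i ] * f i)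
  select f 1 _ _ = sym (trans (+-identityʳ _) (+-identityʳ _))
  select f 2 _ _ = sym (trans (+-identityʳ _) (+-identityʳ _))
  select f 3 _ _ = sym (trans (+-identityʳ _) (+-identityʳ _))
  select f 4 _ _ = sym (trans (+-identityʳ _) (+-identityʳ _))
  select f (suc (suc (suc (suc (suc _))))) _ (s≤s (s≤s (s≤s (s≤s ()))))

  ∑-by-degree : ∀ {a} {A : Set a} (d : A → ℕ) (vs : List A) (f : ℕ → ℕ) →
    (∀ v → 1 ≤ d v) → (∀ v → d v ≤ 4) →
    ∑ vs (λ v → f (d v)) ≡ ∑ degrees (λ i → count d vs i * f i)
  ∑-by-degree d vs f 1≤d d≤4 = begin
      ∑ vs (λ v → f (d v))
    ≡⟨ ∑-cong vs (λ v → select f (d v) (1≤d v) (d≤4 v)) ⟩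
      ∑ vs (λ v → ∑ degrees (λ i → [ d v ≟ i ] * f i))
    ≡⟨ ∑-swap vs degrees (λ v i → [ d v ≟ i ] * f i) ⟩
      ∑ degrees (λ i → ∑ vs (λ v → [ d v ≟ i ] * f i))
    ≡⟨ ∑-cong degrees (λ i → trans (∑-*ʳ vs _ (f i)) (cong (_* f i) (sym (length-filter (λ v → d v ≟ i) vs)))) ⟩
      ∑ degrees (λ i → count d vs i * f i)
    ∎
    where open ≡-Reasoning

module Arithmetic where

  open import Data.Nat as ℕ using ()
  import Data.Nat.Properties as ℕP
  open import Data.Integer using (ℤ; +_; _+_; _-_; _*_) renaming (_≤_ to _≤ℤ_)
  import Data.Integer.Properties as ℤP
  open import Data.Product using (_×_; _,_)
  open import Function.Bundles using (_⇔_; mk⇔; Equivalence)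
  open import Relation.Binary.PropositionalEquality using (_≡_; refl; sym; trans; cong; cong₂; subst; module ≡-Reasoning)
  import Data.Nat.Tactic.RingSolver as ℕ-Solver
  import Data.Integer.Tactic.RingSolver as ℤ-Solver

  -- Eliminating N, D and Q from the three degree moments
  --   N = x₁ + x₂ + x₃ + x₄,  D = x₁ + 2x₂ + 3x₃ + 4x₄,  Q = x₂ + 3x₃ + 6x₄
  -- gives x₁ + x₄ = 3N − 2D + Q and x₃ + 3x₄ = N − D + Q.
  eliminate : ∀ x₁ x₂ x₃ x₄ n d q →
    x₁ ℕ.* 1 ℕ.+ (x₂ ℕ.* 1 ℕ.+ (x₃ ℕ.* 1 ℕ.+ (x₄ ℕ.* 1 ℕ.+ 0))) ≡ n →
    x₁ ℕ.* 1 ℕ.+ (x₂ ℕ.* 2 ℕ.+ (x₃ ℕ.* 3 ℕ.+ (x₄ ℕ.* 4 ℕ.+ 0))) ≡ d →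
    x₁ ℕ.* 0 ℕ.+ (x₂ ℕ.* 1 ℕ.+ (x₃ ℕ.* 3 ℕ.+ (x₄ ℕ.* 6 ℕ.+ 0))) ≡ q →
    (x₁ ℕ.+ x₄ ℕ.+ 2 ℕ.* d ≡ 3 ℕ.* n ℕ.+ q) × (x₃ ℕ.+ 3 ℕ.* x₄ ℕ.+ d ≡ n ℕ.+ q)
  eliminate x₁ x₂ x₃ x₄ _ _ _ refl refl refl = combination₁ x₁ x₂ x₃ x₄ , combination₂ x₁ x₂ x₃ x₄
    where
      combination₁ : ∀ x₁ x₂ x₃ x₄ →
        x₁ ℕ.+ x₄ ℕ.+ 2 ℕ.* (x₁ ℕ.* 1 ℕ.+ (x₂ ℕ.* 2 ℕ.+ (x₃ ℕ.* 3 ℕ.+ (x₄ ℕ.* 4 ℕ.+ 0))))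
          ≡ 3 ℕ.* (x₁ ℕ.* 1 ℕ.+ (x₂ ℕ.* 1 ℕ.+ (x₃ ℕ.* 1 ℕ.+ (x₄ ℕ.* 1 ℕ.+ 0))))
            ℕ.+ (x₁ ℕ.* 0 ℕ.+ (x₂ ℕ.* 1 ℕ.+ (x₃ ℕ.* 3 ℕ.+ (x₄ ℕ.* 6 ℕ.+ 0))))
      combination₁ = ℕ-Solver.solve-∀
      combination₂ : ∀ x₁ x₂ x₃ x₄ →
        x₃ ℕ.+ 3 ℕ.* x₄ ℕ.+ (x₁ ℕ.* 1 ℕ.+ (x₂ ℕ.* 2 ℕ.+ (x₃ ℕ.* 3 ℕ.+ (x₄ ℕ.* 4 ℕ.+ 0))))
          ≡ (x₁ ℕ.* 1 ℕ.+ (x₂ ℕ.* 1 ℕ.+ (x₃ ℕ.* 1 ℕ.+ (x₄ ℕ.* 1 ℕ.+ 0))))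
            ℕ.+ (x₁ ℕ.* 0 ℕ.+ (x₂ ℕ.* 1 ℕ.+ (x₃ ℕ.* 3 ℕ.+ (x₄ ℕ.* 6 ℕ.+ 0))))
      combination₂ = ℕ-Solver.solve-∀

  firstIdentityℤ : ∀ x₁ x₄ r τ h a b c →
    x₁ ℕ.+ x₄ ℕ.+ 2 ℕ.* (r ℕ.* h) ≡ 3 ℕ.* (r ℕ.* τ ℕ.+ a) ℕ.+ (c ℕ.+ b) →
    + x₁ + + x₄ ≡ + c + + 3 * + r * + τ - + 2 * + r * + h + + (b ℕ.+ 3 ℕ.* a)
  firstIdentityℤ x₁ x₄ r τ h a b c eq = begin
      X₁ + X₄
    ≡⟨ isolate X₁ X₄ R H ⟩
      X₁ + X₄ + + 2 * (R * H) - + 2 * R * H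
    ≡⟨ cong (_- + 2 * R * H) eqℤ ⟩
      + 3 * (R * T + A) + (C + B) - + 2 * R * H
    ≡⟨ regroup R T H A B C ⟩
      C + + 3 * R * T - + 2 * R * H + (B + + 3 * A)
    ≡⟨ cong (λ z → C + + 3 * R * T - + 2 * R * H + z) (sym slack) ⟩
      C + + 3 * R * T - + 2 * R * H + + (b ℕ.+ 3 ℕ.* a)
    ∎
    where
      open ≡-Reasoning
      X₁ = + x₁ ; X₄ = + x₄ ; R = + r ; T = + τ ; H = + h ; A = + a ; B = + b ; C = + c
      isolate : ∀ X₁ X₄ R H → X₁ + X₄ ≡ X₁ + X₄ + + 2 * (R * H) - + 2 * R * H
      isolate = ℤ-Solver.solve-∀
      regroup : ∀ R T H A B C → + 3 * (R * T + A) + (C + B) - + 2 * R * H ≡ C + + 3 * R * T - + 2 * R * H + (B + + 3 * A)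
      regroup = ℤ-Solver.solve-∀
      eqℤ : X₁ + X₄ + + 2 * (R * H) ≡ + 3 * (R * T + A) + (C + B)
      eqℤ = begin
          X₁ + X₄ + + 2 * (R * H)
        ≡⟨ cong₂ _+_ (sym (ℤP.pos-+ x₁ x₄)) (cong (+ 2 *_) (sym (ℤP.pos-* r h))) ⟩
          + (x₁ ℕ.+ x₄) + + 2 * + (r ℕ.* h)
        ≡⟨ cong (λ z → + (x₁ ℕ.+ x₄) + z) (sym (ℤP.pos-* 2 (r ℕ.* h))) ⟩
          + (x₁ ℕ.+ x₄) + + (2 ℕ.* (r ℕ.* h))
        ≡⟨ sym (ℤP.pos-+ (x₁ ℕ.+ x₄) _) ⟩
          + (x₁ ℕ.+ x₄ ℕ.+ 2 ℕ.* (r ℕ.* h))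
        ≡⟨ cong +_ eq ⟩
          + (3 ℕ.* (r ℕ.* τ ℕ.+ a) ℕ.+ (c ℕ.+ b))
        ≡⟨ ℤP.pos-+ (3 ℕ.* (r ℕ.* τ ℕ.+ a)) (c ℕ.+ b) ⟩
          + (3 ℕ.* (r ℕ.* τ ℕ.+ a)) + + (c ℕ.+ b)
        ≡⟨ cong₂ _+_ (ℤP.pos-* 3 (r ℕ.* τ ℕ.+ a)) (ℤP.pos-+ c b) ⟩
          + 3 * + (r ℕ.* τ ℕ.+ a) + (C + B)
        ≡⟨ cong (λ z → + 3 * z + (C + B)) (trans (ℤP.pos-+ (r ℕ.* τ) a) (cong (_+ A) (ℤP.pos-* r τ))) ⟩
          + 3 * (R * T + A) + (C + B)
        ∎
      slack : + (b ℕ.+ 3 ℕ.* a) ≡ B + + 3 * A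
      slack = trans (ℤP.pos-+ b (3 ℕ.* a)) (cong (λ z → B + z) (ℤP.pos-* 3 a))

  secondIdentityℤ : ∀ x₃ x₄ r τ h a b c →
    x₃ ℕ.+ 3 ℕ.* x₄ ℕ.+ r ℕ.* h ≡ r ℕ.* τ ℕ.+ a ℕ.+ (c ℕ.+ b) →
    + x₃ + + 3 * + x₄ ≡ + c + + r * + τ - + r * + h + + (b ℕ.+ a)
  secondIdentityℤ x₃ x₄ r τ h a b c eq = begin
      X₃ + + 3 * X₄
    ≡⟨ isolate X₃ X₄ R H ⟩
      X₃ + + 3 * X₄ + R * H - R * H
    ≡⟨ cong (_- R * H) eqℤ ⟩
      R * T + A + (C + B) - R * H
    ≡⟨ regroup R T H A B C ⟩
      C + R * T - R * H + (B + A)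
    ≡⟨ cong (λ z → C + R * T - R * H + z) (sym (ℤP.pos-+ b a)) ⟩
      C + R * T - R * H + + (b ℕ.+ a)
    ∎
    where
      open ≡-Reasoning
      X₃ = + x₃ ; X₄ = + x₄ ; R = + r ; T = + τ ; H = + h ; A = + a ; B = + b ; C = + c
      isolate : ∀ X₃ X₄ R H → X₃ + + 3 * X₄ ≡ X₃ + + 3 * X₄ + R * H - R * H
      isolate = ℤ-Solver.solve-∀
      regroup : ∀ R T H A B C → R * T + A + (C + B) - R * H ≡ C + R * T - R * H + (B + A)
      regroup = ℤ-Solver.solve-∀
      eqℤ : X₃ + + 3 * X₄ + R * H ≡ R * T + A + (C + B)
      eqℤ = begin
          X₃ + + 3 * X₄ + R * H
        ≡⟨ cong₂ _+_ (cong (λ z → X₃ + z) (sym (ℤP.pos-* 3 x₄))) (sym (ℤP.pos-* r h)) ⟩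
          X₃ + + (3 ℕ.* x₄) + + (r ℕ.* h)
        ≡⟨ cong (_+ + (r ℕ.* h)) (sym (ℤP.pos-+ x₃ (3 ℕ.* x₄))) ⟩
          + (x₃ ℕ.+ 3 ℕ.* x₄) + + (r ℕ.* h)
        ≡⟨ sym (ℤP.pos-+ (x₃ ℕ.+ 3 ℕ.* x₄) (r ℕ.* h)) ⟩
          + (x₃ ℕ.+ 3 ℕ.* x₄ ℕ.+ r ℕ.* h)
        ≡⟨ cong +_ eq ⟩
          + (r ℕ.* τ ℕ.+ a ℕ.+ (c ℕ.+ b))
        ≡⟨ ℤP.pos-+ (r ℕ.* τ ℕ.+ a) (c ℕ.+ b) ⟩
          + (r ℕ.* τ ℕ.+ a) + + (c ℕ.+ b)
        ≡⟨ cong₂ _+_ (trans (ℤP.pos-+ (r ℕ.* τ) a) (cong (_+ A) (ℤP.pos-* r τ))) (ℤP.pos-+ c b) ⟩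
          R * T + A + (C + B)
        ∎

  boundWithSlack : ∀ {A : Set} {L R : ℤ} (k : ℕ) → L ≡ R + + k → (k ≡ 0 ⇔ A) → (R ≤ℤ L) × ((L ≡ R) ⇔ A)
  boundWithSlack {L = L} {R} k L≡R+k k≡0⇔A =
    subst (R ≤ℤ_) (sym L≡R+k) (ℤP.i≤i+j R (+ k)) ,
    mk⇔ (λ L≡R → Equivalence.to k≡0⇔A (ℤP.+-injective (slack≡0 L≡R)))
        (λ a → trans L≡R+k (trans (cong (λ t → R + + t) (Equivalence.from k≡0⇔A a)) (ℤP.+-identityʳ R)))
    where
      open ≡-Reasoning
      difference : ∀ R K → K ≡ R + K - R
      difference = ℤ-Solver.solve-∀
      slack≡0 : L ≡ R → + k ≡ + 0
      slack≡0 L≡R = begin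
          + k           ≡⟨ difference R (+ k) ⟩
          R + + k - R   ≡⟨ cong (_- R) (sym L≡R+k) ⟩
          L - R         ≡⟨ cong (_- R) L≡R ⟩
          R - R         ≡⟨ ℤP.+-inverseʳ R ⟩
          + 0           ∎

  3*≡0⇔ : ∀ {a : ℕ} → (3 ℕ.* a ≡ 0) ⇔ (a ≡ 0)
  3*≡0⇔ {a} = mk⇔ (λ eq → ℕP.m*n≡0⇒m≡0 a 3 (trans (ℕP.*-comm a 3) eq)) (λ { refl → refl })

open import Data.Nat.Combinatorics using (_C_)
open import Data.Integer using (ℤ; +_; _+_; _-_; _*_) renaming (_≤_ to _≤ℤ_)
open import Data.List using (length)
open import Data.Product using (_×_; _,_; proj₁; proj₂)
open import Function.Bundles using (_⇔_)
open import Relation.Binary.PropositionalEquality using (_≡_; sym; trans)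
open import Data.Product.Function.NonDependent.Propositional using (_×-⇔_)
import Function.Properties.Equivalence as ⇔
import Data.Nat as ℕ
open DoubleCounting using (handshake; pairCount)
open Surplus using (vertexSurplus; pairSurplus; +≡0⇔)
open FiniteSums using (∑)
open DegreeDistribution using (degrees; ∑-by-degree)
open Arithmetic

lemma4 : (r : ℕ) (m : Fin r → ℕ) (H : Hypergraph r m) (τ : ℕ) →
  IsCoveringNumber H τ →
  Intersecting H →
  ((v : Vertex r m) → 1 ≤ deg H v) →
  ((v : Vertex r m) → deg H v ≤ 4) →
  let x : ℕ → ℤ
      x i = + numDeg H i
      h = length H
      L₁ = x 1 + x 4
      R₁ = + (h C 2) + + 3 * + r * + τ - + 2 * + r * + h
      L₂ = x 3 + + 3 * x 4
      R₂ = + (h C 2) + + r * + τ - + r * + h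
      Eq = Linear H × ((j : Fin r) → m j ≡ τ)
  in (R₁ ≤ℤ L₁) × (R₂ ≤ℤ L₂) × ((L₁ ≡ R₁) ⇔ Eq) × ((L₂ ≡ R₂) ⇔ Eq)
lemma4 r m H τ cover intersecting deg≥1 deg≤4
  with vertexSurplus H τ cover | pairSurplus H intersecting
... | a , N≡ , a≡0⇔ | b , pairs≡ , b≡0⇔ = proj₁ bound₁ , proj₁ bound₂ , proj₂ bound₁ , proj₂ bound₂
  where
    h : ℕ
    h = length H
    x : ℕ → ℕ
    x = numDeg H
    Eq : Set
    Eq = Linear H × ((j : Fin r) → m j ≡ τ)
    byDegree : (f : ℕ → ℕ) → ∑ vertices (λ v → f (deg H v)) ≡ ∑ degrees (λ i → x i ℕ.* f i)
    byDegree f = ∑-by-degree (deg H) vertices f deg≥1 deg≤4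
    moments : (x 1 ℕ.+ x 4 ℕ.+ 2 ℕ.* (r ℕ.* h) ≡ 3 ℕ.* (r ℕ.* τ ℕ.+ a) ℕ.+ (h C 2 ℕ.+ b))
            × (x 3 ℕ.+ 3 ℕ.* x 4 ℕ.+ r ℕ.* h ≡ r ℕ.* τ ℕ.+ a ℕ.+ (h C 2 ℕ.+ b))
    moments = eliminate (x 1) (x 2) (x 3) (x 4) _ _ _
      (trans (sym (byDegree (λ _ → 1))) N≡)
      (trans (sym (byDegree (λ d → d))) (handshake H))
      (trans (sym (byDegree (λ d → d C 2))) (trans (pairCount H) pairs≡))
    bound₁ : (+ (h C 2) + + 3 * + r * + τ - + 2 * + r * + h ≤ℤ + x 1 + + x 4)
           × ((+ x 1 + + x 4 ≡ + (h C 2) + + 3 * + r * + τ - + 2 * + r * + h) ⇔ Eq)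
    bound₁ = boundWithSlack (b ℕ.+ 3 ℕ.* a)
      (firstIdentityℤ (x 1) (x 4) r τ h a b (h C 2) (proj₁ moments))
      (⇔.trans +≡0⇔ (b≡0⇔ ×-⇔ ⇔.trans 3*≡0⇔ a≡0⇔))
    bound₂ : (+ (h C 2) + + r * + τ - + r * + h ≤ℤ + x 3 + + 3 * + x 4)
           × ((+ x 3 + + 3 * + x 4 ≡ + (h C 2) + + r * + τ - + r * + h) ⇔ Eq)
    bound₂ = boundWithSlack (b ℕ.+ a)
      (secondIdentityℤ (x 3) (x 4) r τ h a b (h C 2) (proj₂ moments))
      (⇔.trans +≡0⇔ (b≡0⇔ ×-⇔ a≡0⇔))
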